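{- Let $p$ be a prime and let $\Delta=HS_d\subseteq\mathbb{R}^d$ be a $p$-power simplex with $H\in\mathbb{Z}^{d\times d}$ in Hermite normal form of the shape \[H=\begin{pmatrix}E_{d-r}&B\\0&C\end{pmatrix},\qquad B\in\mathbb{Z}^{(d-r)\times r},\ C\in\mathbb{Z}^{r\times r}.\] Then $\operatorname{cr}(\Delta)=r$ if and only if $C=p\,E_r$.
   Context: $S_d=\operatorname{conv}\{\mathbf{0},e_1,\ldots,e_d\}$, $E_\ell$ is the $\ell\times\ell$ identity matrix. A matrix $H=(h_{ij})\in\mathbb{Z}^{d\times d}$ is in Hermite normal form if it is upper triangular with positive diagonal entries and $0\le h_{ij}<h_{jj}$ for all $1\le i<j\le d$. For a lattice simplex $\Delta=AS_d$ ($A$ invertible integer matrix), $G_\Delta=\mathbb{Z}^d/A\mathbb{Z}^d$ and $\operatorname{cr}(\Delta)$ is the number of elementary divisors of $A$ larger than $1$. For a prime $p$, a $p$-power simplex is a lattice simplex $\Delta$ with $G_\Delta\cong(\mathbb{Z}_p)^s$ for some $s\ge0$. -}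

module Defs where

open import Data.Nat as ℕ using (ℕ; zero; suc)
open import Data.Nat.Divisibility as ℕD using ()
open import Data.Integer as ℤ using (ℤ; +_; _-_)
open import Data.Integer.Divisibility as ℤD using ()
open import Data.Fin as Fin using (Fin; toℕ)
open import Data.Product using (Σ; ∃; _×_; _,_)
open import Relation.Binary.PropositionalEquality using (_≡_)
open import Relation.Nullary using (Dec; yes; no)
open import Function.Bundles using (_⇔_)

Mat : ℕ → ℕ → Set
Mat m n = Fin m → Fin n → ℤ

Vecℤ : ℕ → Set
Vecℤ n = Fin n → ℤ

sumℤ : {n : ℕ} → (Fin n → ℤ) → ℤ
sumℤ {zero}  f = + 0
sumℤ {suc n} f = f Fin.zero ℤ.+ sumℤ (λ i → f (Fin.suc i))

count>1 : {n : ℕ} → (Fin n → ℕ) → ℕ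
count>1 {zero}  f = 0
count>1 {suc n} f with 1 ℕ.<? f Fin.zero
... | yes _ = suc (count>1 (λ i → f (Fin.suc i)))
... | no  _ = count>1 (λ i → f (Fin.suc i))

_⊗_ : {m n k : ℕ} → Mat m n → Mat n k → Mat m k
(A ⊗ B) i j = sumℤ (λ l → A i l ℤ.* B l j)

_·_ : {m n : ℕ} → Mat m n → Vecℤ n → Vecℤ m
(A · x) i = sumℤ (λ l → A i l ℤ.* x l)

Id : (n : ℕ) → Mat n n
Id n i j with i Fin.≟ j
... | yes _ = + 1
... | no  _ = + 0

scalarMat : (n : ℕ) → ℤ → Mat n n
scalarMat n c i j with i Fin.≟ j
... | yes _ = c
... | no  _ = + 0

diagMat : {n : ℕ} → (Fin n → ℕ) → Mat n n
diagMat D i j with i Fin.≟ j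
... | yes _ = + (D i)
... | no  _ = + 0

Unimodular : {n : ℕ} → Mat n n → Set
Unimodular {n} U = Σ (Mat n n) λ V →
  (∀ i j → (U ⊗ V) i j ≡ Id n i j) × (∀ i j → (V ⊗ U) i j ≡ Id n i j)

IsHNF : {d : ℕ} → Mat d d → Set
IsHNF {d} H =
  (∀ (i j : Fin d) → j Fin.< i → H i j ≡ + 0) ×
  (∀ (i : Fin d) → + 0 ℤ.< H i i) ×
  (∀ (i j : Fin d) → i Fin.< j → (+ 0 ℤ.≤ H i j) × (H i j ℤ.< H j j))

ElementaryDivisors : {n : ℕ} → Mat n n → (Fin n → ℕ) → Set
ElementaryDivisors {n} A D =
  (∀ i → 0 ℕ.< D i) ×
  (∀ i j → toℕ i ℕ.≤ toℕ j → D i ℕD.∣ D j) ×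
  Σ (Mat n n) λ U → Σ (Mat n n) λ V →
    Unimodular U × Unimodular V × (∀ i j → ((U ⊗ A) ⊗ V) i j ≡ diagMat D i j)

-- cr(A S_d) = c : the number of elementary divisors of A larger than 1 is c.
-- (Elementary divisors are unique, so this is a functional relation.)
HasCr : {d : ℕ} → Mat d d → ℕ → Set
HasCr A c = Σ _ λ D → ElementaryDivisors A D × (count>1 D ≡ c)

InLattice : {d : ℕ} → Mat d d → Vecℤ d → Set
InLattice {d} A x = Σ (Vecℤ d) λ y → ∀ i → x i ≡ (A · y) i

infix 4 _≡[mod_]_
_≡[mod_]_ : ℤ → ℕ → ℤ → Set
a ≡[mod p ] b = (+ p) ℤD.∣ (a - b)

-- G_Δ = ℤ^d / A ℤ^d is isomorphic to (ℤ/pℤ)^s: there is a group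
-- homomorphism f : ℤ^d → (ℤ/pℤ)^s (vectors of integers read mod p)
-- which is surjective and whose kernel is exactly A ℤ^d.
GroupIsoZpPow : {d : ℕ} → Mat d d → ℕ → ℕ → Set
GroupIsoZpPow {d} A p s = Σ (Vecℤ d → Vecℤ s) λ f →
  (∀ x y k → f (λ i → x i ℤ.+ y i) k ≡[mod p ] (f x k ℤ.+ f y k)) ×
  (∀ (z : Vecℤ s) → Σ (Vecℤ d) λ x → ∀ k → f x k ≡[mod p ] z k) ×
  (∀ x → ((∀ k → f x k ≡[mod p ] (+ 0))) ⇔ InLattice A x)

IsPPowerSimplex : {d : ℕ} → ℕ → Mat d d → Set
IsPPowerSimplex p A = ∃ λ s → GroupIsoZpPow A p s

-- Write H = [[E, B], [0, C]] and let U H V = diag(d₁, …, dₙ) be a Smith normal form.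
--
-- If C = pE, the column operation V = [[E, -B], [0, E]] already gives
-- H V = diag(1, …, 1, p, …, p), so exactly r elementary divisors exceed 1.
--
-- Conversely, ℤⁿ/Hℤⁿ ≅ (ℤ/p)^s is killed by p, so pℤⁿ ⊆ Hℤⁿ and every dᵢ divides p;
-- with cr = r and the divisibility chain the last r of them equal p.  Hence a vector
-- w ∈ Hℤⁿ vanishes mod p as soon as the first k coordinates of U w do.  For a column
-- C_{·j}, the k + 1 vectors formed by the top k coordinates of U (0, C_{·j}), U e₁, …,
-- U e_k are dependent mod p, and the combination w = (α₁, …, α_k, α₀ C_{·j}) lies in
-- Hℤⁿ; so all of w vanishes mod p, which forces p ∤ α₀ and hence C ≡ 0 mod p.
-- Finally p e_{k+j} ∈ Hℤⁿ and back substitution in the triangular C give C_jj ∣ p,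
-- so C_jj = p, and the Hermite bounds 0 ≤ C_ij < C_jj kill the entries above the diagonal.

module Submission where

open import Defs
import Data.Integer.Properties as ℤₚ
open import Algebra.Properties.Semiring.Sum ℤₚ.+-*-semiring
  using (sum; sum-cong-≗; ∑-distrib-+; ∑-comm; sum-remove; *-distribˡ-sum; *-distribʳ-sum)
open import Data.Empty using (⊥-elim)
open import Data.Fin using (Fin; zero; suc; toℕ; _≟_; _↑ˡ_; _↑ʳ_; splitAt; punchIn)
import Data.Fin as Fin
import Data.Fin.Properties as Finₚ
open import Data.Integer as ℤ using (ℤ; +_; _-_; -_; _+_; _*_)
import Data.Integer.Divisibility.Signed as ℤ∣
open ℤ∣ using (_∣_)
open import Data.Integer.Tactic.RingSolver using (solve-∀)
open import Data.Nat as ℕ using (ℕ; zero; suc)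
import Data.Nat.Divisibility as ℕ∣
import Data.Nat.Properties as ℕₚ
open import Data.Nat.Primality using (Prime; prime⇒nonTrivial; euclidsLemma; prime⇒irreducible)
open import Data.Product using (Σ; ∃; _×_; _,_; proj₁; proj₂; map₂)
open import Data.Sum using (_⊎_; inj₁; inj₂; [_,_]′)
open import Data.Vec.Functional using (_++_; _∷_; insertAt)
open import Data.Vec.Functional.Properties using (lookup-++ˡ; lookup-++ʳ; insertAt-lookup; insertAt-punchIn)
open import Function using (_∘_; id)
open import Function.Bundles using (_⇔_; mk⇔; Equivalence)
open import Relation.Binary.PropositionalEquality
open import Relation.Binary.Definitions using (Tri; tri<; tri≈; tri>)
open import Relation.Nullary using (Dec; yes; no; ¬_)
open import Relation.Nullary.Decidable using (¬?; decidable-stable)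

-- Finite sums and matrix algebra

sumℤ≡sum : ∀ {n} (f : Fin n → ℤ) → sumℤ f ≡ sum f
sumℤ≡sum {zero}  f = refl
sumℤ≡sum {suc n} f = cong (_+_ (f zero)) (sumℤ≡sum (f ∘ suc))

sumℤ-cong : ∀ {n} {f g : Fin n → ℤ} → (∀ i → f i ≡ g i) → sumℤ f ≡ sumℤ g
sumℤ-cong {f = f} {g} f≗g = trans (sumℤ≡sum f) (trans (sum-cong-≗ {x = f} {g} f≗g) (sym (sumℤ≡sum g)))

sumℤ-zero : ∀ {n} {f : Fin n → ℤ} → (∀ i → f i ≡ + 0) → sumℤ f ≡ + 0
sumℤ-zero {zero}  f≗0 = refl
sumℤ-zero {suc n} f≗0 = cong₂ _+_ (f≗0 zero) (sumℤ-zero (f≗0 ∘ suc))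

sumℤ-distrib-+ : ∀ {n} (f g : Fin n → ℤ) → sumℤ (λ i → f i + g i) ≡ sumℤ f + sumℤ g
sumℤ-distrib-+ f g = begin
  sumℤ (λ i → f i + g i) ≡⟨ sumℤ≡sum (λ i → f i + g i) ⟩
  sum (λ i → f i + g i)  ≡⟨ ∑-distrib-+ f g ⟩
  sum f + sum g          ≡⟨ sym (cong₂ _+_ (sumℤ≡sum f) (sumℤ≡sum g)) ⟩
  sumℤ f + sumℤ g        ∎
  where open ≡-Reasoning

*-distribˡ-sumℤ : ∀ {n} c (f : Fin n → ℤ) → c * sumℤ f ≡ sumℤ (λ i → c * f i)
*-distribˡ-sumℤ c f =
  trans (cong (c *_) (sumℤ≡sum f)) (trans (*-distribˡ-sum c f) (sym (sumℤ≡sum (λ i → c * f i))))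

*-distribʳ-sumℤ : ∀ {n} c (f : Fin n → ℤ) → sumℤ f * c ≡ sumℤ (λ i → f i * c)
*-distribʳ-sumℤ c f =
  trans (cong (_* c) (sumℤ≡sum f)) (trans (*-distribʳ-sum c f) (sym (sumℤ≡sum (λ i → f i * c))))

sumℤ-comm : ∀ {m n} (f : Fin m → Fin n → ℤ) →
  sumℤ (λ i → sumℤ (f i)) ≡ sumℤ (λ j → sumℤ (λ i → f i j))
sumℤ-comm f = trans (nested f) (trans (∑-comm f) (sym (nested (λ j i → f i j))))
  where
  nested : ∀ {m n} (g : Fin m → Fin n → ℤ) → sumℤ (λ i → sumℤ (g i)) ≡ sum (λ i → sum (g i))
  nested g = trans (sumℤ-cong (λ i → sumℤ≡sum (g i))) (sumℤ≡sum (λ i → sum (g i)))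

sumℤ-remove : ∀ {n} (j : Fin (suc n)) (f : Fin (suc n) → ℤ) →
  sumℤ f ≡ f j + sumℤ (f ∘ punchIn j)
sumℤ-remove j f = trans (sumℤ≡sum f) (trans (sum-remove f) (cong (_+_ (f j)) (sym (sumℤ≡sum (f ∘ punchIn j)))))

sumℤ-↑ : ∀ k {r} (f : Fin (k ℕ.+ r) → ℤ) →
  sumℤ f ≡ sumℤ (λ a → f (a ↑ˡ r)) + sumℤ (λ b → f (k ↑ʳ b))
sumℤ-↑ zero    f = sym (ℤₚ.+-identityˡ _)
sumℤ-↑ (suc k) f =
  trans (cong (_+_ (f zero)) (sumℤ-↑ k (f ∘ suc))) (sym (ℤₚ.+-assoc (f zero) _ _))

∣-sumℤ : ∀ {n} {d} {f : Fin n → ℤ} → (∀ i → d ∣ f i) → d ∣ sumℤ f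
∣-sumℤ {zero}  {d} _   = ℤ∣.divides (+ 0) (sym (ℤₚ.*-zeroˡ d))
∣-sumℤ {suc n}     d∣f = ℤ∣.∣m∣n⇒∣m+n (d∣f zero) (∣-sumℤ (d∣f ∘ suc))

Id-diag : ∀ n (i : Fin n) → Id n i i ≡ + 1
Id-diag n i with i ≟ i
... | yes _   = refl
... | no  i≢i = ⊥-elim (i≢i refl)

Id-offdiag : ∀ n {i j : Fin n} → i ≢ j → Id n i j ≡ + 0
Id-offdiag n {i} {j} i≢j with i ≟ j
... | yes i≡j = ⊥-elim (i≢j i≡j)
... | no  _   = refl

scalarMat≡*Id : ∀ n c (i j : Fin n) → scalarMat n c i j ≡ c * Id n i j
scalarMat≡*Id n c i j with i ≟ j
... | yes _ = sym (ℤₚ.*-identityʳ c)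
... | no  _ = sym (ℤₚ.*-zeroʳ c)

diagMat≡*Id : ∀ {n} (D : Fin n → ℕ) (i j : Fin n) → diagMat D i j ≡ + D i * Id n i j
diagMat≡*Id D i j with i ≟ j
... | yes _ = sym (ℤₚ.*-identityʳ (+ D i))
... | no  _ = sym (ℤₚ.*-zeroʳ (+ D i))

Id-sym : ∀ n (i j : Fin n) → Id n i j ≡ Id n j i
Id-sym n i j = case-on (i ≟ j)
  where
  case-on : Dec (i ≡ j) → Id n i j ≡ Id n j i
  case-on (yes refl) = refl
  case-on (no  i≢j)  = trans (Id-offdiag n i≢j) (sym (Id-offdiag n (i≢j ∘ sym)))

Id-injective : ∀ {m n} (f : Fin m → Fin n) → (∀ {a b} → f a ≡ f b → a ≡ b) →
  ∀ a b → Id n (f a) (f b) ≡ Id m a b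
Id-injective {m} {n} f f-inj a b = case-on (a ≟ b)
  where
  case-on : Dec (a ≡ b) → Id n (f a) (f b) ≡ Id m a b
  case-on (yes refl) = trans (Id-diag n (f a)) (sym (Id-diag m a))
  case-on (no  a≢b)  = trans (Id-offdiag n (a≢b ∘ f-inj)) (sym (Id-offdiag m a≢b))

sumℤ-*Id : ∀ {n} (f : Fin n → ℤ) (j : Fin n) → sumℤ (λ l → f l * Id n l j) ≡ f j
sumℤ-*Id {suc n} f j = begin
  sumℤ (λ l → f l * Id (suc n) l j)
    ≡⟨ sumℤ-remove j (λ l → f l * Id (suc n) l j) ⟩
  f j * Id (suc n) j j + sumℤ (λ l → f (punchIn j l) * Id (suc n) (punchIn j l) j)
    ≡⟨ cong₂ _+_ (cong (f j *_) (Id-diag (suc n) j)) (sumℤ-zero off-j) ⟩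
  f j * + 1 + + 0
    ≡⟨ trans (ℤₚ.+-identityʳ _) (ℤₚ.*-identityʳ (f j)) ⟩
  f j ∎
  where
  open ≡-Reasoning
  off-j : ∀ l → f (punchIn j l) * Id (suc n) (punchIn j l) j ≡ + 0
  off-j l = trans (cong (f (punchIn j l) *_) (Id-offdiag (suc n) (Finₚ.punchInᵢ≢i j l)))
                  (ℤₚ.*-zeroʳ (f (punchIn j l)))

sumℤ-Id* : ∀ {n} (i : Fin n) (f : Fin n → ℤ) → sumℤ (λ l → Id n i l * f l) ≡ f i
sumℤ-Id* {n} i f =
  trans (sumℤ-cong (λ l → trans (ℤₚ.*-comm (Id n i l) (f l)) (cong (f l *_) (Id-sym n i l))))
        (sumℤ-*Id f i)

infix 4 _≐_
_≐_ : ∀ {m n} → Mat m n → Mat m n → Set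
A ≐ B = ∀ i j → A i j ≡ B i j

⊗-identityˡ : ∀ {m n} (X : Mat m n) → Id m ⊗ X ≐ X
⊗-identityˡ X i j = sumℤ-Id* i (λ l → X l j)

⊗-identityʳ : ∀ {m n} (X : Mat m n) → X ⊗ Id n ≐ X
⊗-identityʳ X i j = sumℤ-*Id (X i) j

⊗-congˡ : ∀ {m n o} {X X′ : Mat m n} (Y : Mat n o) → X ≐ X′ → X ⊗ Y ≐ X′ ⊗ Y
⊗-congˡ Y X≐X′ i j = sumℤ-cong (λ l → cong (_* Y l j) (X≐X′ i l))

⊗-congʳ : ∀ {m n o} (X : Mat m n) {Y Y′ : Mat n o} → Y ≐ Y′ → X ⊗ Y ≐ X ⊗ Y′
⊗-congʳ X Y≐Y′ i j = sumℤ-cong (λ l → cong (X i l *_) (Y≐Y′ l j))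

·-identityˡ : ∀ {n} (x : Vecℤ n) i → (Id n · x) i ≡ x i
·-identityˡ x i = sumℤ-Id* i x

·-congˡ : ∀ {m n} {A A′ : Mat m n} (x : Vecℤ n) → A ≐ A′ → ∀ i → (A · x) i ≡ (A′ · x) i
·-congˡ x A≐A′ i = sumℤ-cong (λ l → cong (_* x l) (A≐A′ i l))

·-congʳ : ∀ {m n} (A : Mat m n) {x y : Vecℤ n} → (∀ i → x i ≡ y i) → ∀ i → (A · x) i ≡ (A · y) i
·-congʳ A x≗y i = sumℤ-cong (λ l → cong (A i l *_) (x≗y l))

⊗-·-assoc : ∀ {m n o} (A : Mat m n) (B : Mat n o) (x : Vecℤ o) i →
  ((A ⊗ B) · x) i ≡ (A · (B · x)) i
⊗-·-assoc A B x i = begin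
  sumℤ (λ l → sumℤ (λ m → A i m * B m l) * x l)
    ≡⟨ sumℤ-cong (λ l → *-distribʳ-sumℤ (x l) (λ m → A i m * B m l)) ⟩
  sumℤ (λ l → sumℤ (λ m → A i m * B m l * x l))
    ≡⟨ sumℤ-comm (λ l m → A i m * B m l * x l) ⟩
  sumℤ (λ m → sumℤ (λ l → A i m * B m l * x l))
    ≡⟨ sumℤ-cong (λ m → sumℤ-cong (λ l → ℤₚ.*-assoc (A i m) (B m l) (x l))) ⟩
  sumℤ (λ m → sumℤ (λ l → A i m * (B m l * x l)))
    ≡⟨ sumℤ-cong (λ m → *-distribˡ-sumℤ (A i m) (λ l → B m l * x l)) ⟨
  sumℤ (λ m → A i m * sumℤ (λ l → B m l * x l)) ∎
  where open ≡-Reasoning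

inverse-· : ∀ {n} (M M⁻¹ : Mat n n) → M ⊗ M⁻¹ ≐ Id n → ∀ x i → (M · (M⁻¹ · x)) i ≡ x i
inverse-· M M⁻¹ M⊗M⁻¹ x i =
  trans (sym (⊗-·-assoc M M⁻¹ x i)) (trans (·-congˡ x M⊗M⁻¹ i) (·-identityˡ x i))

diagMat-· : ∀ {n} (D : Fin n → ℕ) (y : Vecℤ n) i → (diagMat D · y) i ≡ + D i * y i
diagMat-· {n} D y i = begin
  sumℤ (λ l → diagMat D i l * y l)
    ≡⟨ sumℤ-cong (λ l → cong (_* y l) (diagMat≡*Id D i l)) ⟩
  sumℤ (λ l → + D i * Id n i l * y l)
    ≡⟨ sumℤ-cong (λ l → ℤₚ.*-assoc (+ D i) (Id n i l) (y l)) ⟩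
  sumℤ (λ l → + D i * (Id n i l * y l))
    ≡⟨ *-distribˡ-sumℤ (+ D i) (λ l → Id n i l * y l) ⟨
  + D i * sumℤ (λ l → Id n i l * y l)
    ≡⟨ cong (+ D i *_) (sumℤ-Id* i y) ⟩
  + D i * y i ∎
  where open ≡-Reasoning

-- Counting entries larger than 1

count>1-cong : ∀ {n} {f g : Fin n → ℕ} → (∀ i → f i ≡ g i) → count>1 f ≡ count>1 g
count>1-cong {zero}          f≗g = refl
count>1-cong {suc n} {f} {g} f≗g with 1 ℕ.<? f zero | 1 ℕ.<? g zero
... | yes _  | yes _  = cong suc (count>1-cong (f≗g ∘ suc))
... | no  _  | no  _  = count>1-cong (f≗g ∘ suc)
... | yes fz | no ¬gz = ⊥-elim (¬gz (subst (1 ℕ.<_) (f≗g zero) fz))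
... | no ¬fz | yes gz = ⊥-elim (¬fz (subst (1 ℕ.<_) (sym (f≗g zero)) gz))

count>1-↑ : ∀ k {r} (f : Fin (k ℕ.+ r) → ℕ) →
  count>1 f ≡ count>1 (λ a → f (a ↑ˡ r)) ℕ.+ count>1 (λ b → f (k ↑ʳ b))
count>1-↑ zero    f = refl
count>1-↑ (suc k) f with 1 ℕ.<? f zero
... | yes _ = cong suc (count>1-↑ k (f ∘ suc))
... | no  _ = count>1-↑ k (f ∘ suc)

count>1-none : ∀ {n} (f : Fin n → ℕ) → (∀ i → f i ℕ.≤ 1) → count>1 f ≡ 0
count>1-none {zero}  f f≤1 = refl
count>1-none {suc n} f f≤1 with 1 ℕ.<? f zero
... | yes 1<f = ⊥-elim (ℕₚ.<⇒≱ 1<f (f≤1 zero))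
... | no  _   = count>1-none (f ∘ suc) (f≤1 ∘ suc)

count>1-all : ∀ {n} (f : Fin n → ℕ) → (∀ i → 1 ℕ.< f i) → count>1 f ≡ n
count>1-all {zero}  f 1<f = refl
count>1-all {suc n} f 1<f with 1 ℕ.<? f zero
... | yes _   = cong suc (count>1-all (f ∘ suc) (1<f ∘ suc))
... | no  1≮f = ⊥-elim (1≮f (1<f zero))

count>1≤length : ∀ {n} (f : Fin n → ℕ) → count>1 f ℕ.≤ n
count>1≤length {zero}  f = ℕ.z≤n
count>1≤length {suc n} f with 1 ℕ.<? f zero
... | yes _ = ℕ.s≤s (count>1≤length (f ∘ suc))
... | no  _ = ℕₚ.m≤n⇒m≤1+n (count>1≤length (f ∘ suc))

count>1≡length⇒all : ∀ {n} (f : Fin n → ℕ) → count>1 f ≡ n → ∀ i → 1 ℕ.< f i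
count>1≡length⇒all {suc n} f count≡ i with 1 ℕ.<? f zero
count>1≡length⇒all {suc n} f count≡ zero    | yes 1<f = 1<f
count>1≡length⇒all {suc n} f count≡ (suc i) | yes _   =
  count>1≡length⇒all (f ∘ suc) (ℕₚ.suc-injective count≡) i
... | no _ = ⊥-elim (ℕₚ.<⇒≱ (ℕₚ.≤-reflexive (sym count≡)) (count>1≤length (f ∘ suc)))

count>1≡r⇒last>1 : ∀ k {r} (f : Fin (k ℕ.+ r) → ℕ) → (∀ i → 0 ℕ.< f i) →
  (∀ i j → toℕ i ℕ.≤ toℕ j → f i ℕ∣.∣ f j) → count>1 f ≡ r → ∀ b → 1 ℕ.< f (k ↑ʳ b)
count>1≡r⇒last>1 zero    f _   _     count≡ = count>1≡length⇒all f count≡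
count>1≡r⇒last>1 (suc k) {r} f pos chain count≡ with 1 ℕ.<? f zero
... | yes 1<f₀ = ⊥-elim (ℕₚ.m≢1+n+m r (trans (sym count≡) (cong suc (count>1-all (f ∘ suc) (all>1 ∘ suc)))))
  where
  all>1 : ∀ j → 1 ℕ.< f j
  all>1 j = ℕₚ.<-≤-trans 1<f₀ (ℕ∣.∣⇒≤ ⦃ ℕ.>-nonZero (pos j) ⦄ (chain zero j ℕ.z≤n))
... | no _ = count>1≡r⇒last>1 k (f ∘ suc) (pos ∘ suc) (λ i j i≤j → chain (suc i) (suc j) (ℕ.s≤s i≤j)) count≡

-- Block upper triangular matrices

↑-cases : ∀ k {r} (P : Fin (k ℕ.+ r) → Set) →
  (∀ a → P (a ↑ˡ r)) → (∀ b → P (k ↑ʳ b)) → ∀ i → P i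
↑-cases k {r} P left right i with splitAt k i in eq
... | inj₁ a = subst P (Finₚ.splitAt⁻¹-↑ˡ eq) (left a)
... | inj₂ b = subst P (Finₚ.splitAt⁻¹-↑ʳ eq) (right b)

≐-byBlocks : ∀ k r {X Y : Mat (k ℕ.+ r) (k ℕ.+ r)} →
  (∀ a b → X (a ↑ˡ r) (b ↑ˡ r) ≡ Y (a ↑ˡ r) (b ↑ˡ r)) →
  (∀ a b → X (a ↑ˡ r) (k ↑ʳ b) ≡ Y (a ↑ˡ r) (k ↑ʳ b)) →
  (∀ a b → X (k ↑ʳ a) (b ↑ˡ r) ≡ Y (k ↑ʳ a) (b ↑ˡ r)) →
  (∀ a b → X (k ↑ʳ a) (k ↑ʳ b) ≡ Y (k ↑ʳ a) (k ↑ʳ b)) →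
  X ≐ Y
≐-byBlocks k r {X} {Y} ll lr rl rr = ↑-cases k (λ i → ∀ j → X i j ≡ Y i j)
  (λ a → ↑-cases k (λ j → X (a ↑ˡ r) j ≡ Y (a ↑ˡ r) j) (ll a) (lr a))
  (λ a → ↑-cases k (λ j → X (k ↑ʳ a) j ≡ Y (k ↑ʳ a) j) (rl a) (rr a))

toℕ↑ˡ<toℕ↑ʳ : ∀ {k r} (a : Fin k) (b : Fin r) → toℕ (a ↑ˡ r) ℕ.< toℕ (k ↑ʳ b)
toℕ↑ˡ<toℕ↑ʳ {k} {r} a b = begin-strict
  toℕ (a ↑ˡ r) ≡⟨ Finₚ.toℕ-↑ˡ a r ⟩
  toℕ a        <⟨ Finₚ.toℕ<n a ⟩
  k            ≤⟨ ℕₚ.m≤m+n k (toℕ b) ⟩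
  k ℕ.+ toℕ b  ≡⟨ sym (Finₚ.toℕ-↑ʳ k b) ⟩
  toℕ (k ↑ʳ b) ∎
  where open ℕₚ.≤-Reasoning

↑ˡ≢↑ʳ : ∀ {k r} (a : Fin k) (b : Fin r) → a ↑ˡ r ≢ k ↑ʳ b
↑ˡ≢↑ʳ a b eq = ℕₚ.<-irrefl (cong toℕ eq) (toℕ↑ˡ<toℕ↑ʳ a b)

↑ʳ-mono-< : ∀ k {r} {i j : Fin r} → i Fin.< j → k ↑ʳ i Fin.< k ↑ʳ j
↑ʳ-mono-< k {i = i} {j} i<j =
  subst₂ ℕ._<_ (sym (Finₚ.toℕ-↑ʳ k i)) (sym (Finₚ.toℕ-↑ʳ k j)) (ℕₚ.+-monoʳ-< k i<j)

module Blocks (k r : ℕ) where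

  n : ℕ
  n = k ℕ.+ r

  zeros : Vecℤ k
  zeros _ = + 0

  upperRows : Mat k k → Mat k r → Fin k → Vecℤ n
  upperRows A B a = A a ++ B a

  lowerRows : Mat r r → Fin r → Vecℤ n
  lowerRows D c = zeros ++ D c

  upperBlock : Mat k k → Mat k r → Mat r r → Mat n n
  upperBlock A B D = upperRows A B ++ lowerRows D

  module _ {A : Mat k k} {B : Mat k r} {D : Mat r r} where

    private
      upperRow : ∀ a → upperBlock A B D (a ↑ˡ r) ≡ A a ++ B a
      upperRow = lookup-++ˡ (upperRows A B) (lowerRows D)
      lowerRow : ∀ a → upperBlock A B D (k ↑ʳ a) ≡ zeros ++ D a
      lowerRow = lookup-++ʳ (upperRows A B) (lowerRows D)

    upperBlock-ll : ∀ a b → upperBlock A B D (a ↑ˡ r) (b ↑ˡ r) ≡ A a b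
    upperBlock-ll a b = trans (cong-app (upperRow a) (b ↑ˡ r)) (lookup-++ˡ (A a) (B a) b)

    upperBlock-lr : ∀ a b → upperBlock A B D (a ↑ˡ r) (k ↑ʳ b) ≡ B a b
    upperBlock-lr a b = trans (cong-app (upperRow a) (k ↑ʳ b)) (lookup-++ʳ (A a) (B a) b)

    upperBlock-rl : ∀ a b → upperBlock A B D (k ↑ʳ a) (b ↑ˡ r) ≡ + 0
    upperBlock-rl a b = trans (cong-app (lowerRow a) (b ↑ˡ r)) (lookup-++ˡ zeros (D a) b)

    upperBlock-rr : ∀ a b → upperBlock A B D (k ↑ʳ a) (k ↑ʳ b) ≡ D a b
    upperBlock-rr a b = trans (cong-app (lowerRow a) (k ↑ʳ b)) (lookup-++ʳ zeros (D a) b)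

  upperBlock-cong : ∀ {A A′ B B′ D D′} → A ≐ A′ → B ≐ B′ → D ≐ D′ →
    upperBlock A B D ≐ upperBlock A′ B′ D′
  upperBlock-cong A≐ B≐ D≐ = ≐-byBlocks k r
    (λ a b → trans (upperBlock-ll a b) (trans (A≐ a b) (sym (upperBlock-ll a b))))
    (λ a b → trans (upperBlock-lr a b) (trans (B≐ a b) (sym (upperBlock-lr a b))))
    (λ a b → trans (upperBlock-rl a b) (sym (upperBlock-rl a b)))
    (λ a b → trans (upperBlock-rr a b) (trans (D≐ a b) (sym (upperBlock-rr a b))))

  ⊗-↑ : (X Y : Mat n n) (i j : Fin n) → (X ⊗ Y) i j ≡
    sumℤ (λ a → X i (a ↑ˡ r) * Y (a ↑ˡ r) j) + sumℤ (λ b → X i (k ↑ʳ b) * Y (k ↑ʳ b) j)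
  ⊗-↑ X Y i j = sumℤ-↑ k (λ l → X i l * Y l j)

  upperBlock-⊗ : ∀ A B D A′ B′ D′ →
    upperBlock A B D ⊗ upperBlock A′ B′ D′ ≐
    upperBlock (A ⊗ A′) (λ a b → (A ⊗ B′) a b + (B ⊗ D′) a b) (D ⊗ D′)
  upperBlock-⊗ A B D A′ B′ D′ = ≐-byBlocks k r
    (λ a b → trans (⊗-↑ X Y _ _) (trans (cong₂ _+_
      (sumℤ-cong (λ m → cong₂ _*_ (upperBlock-ll a m) (upperBlock-ll m b)))
      (sumℤ-zero (λ m → trans (cong₂ _*_ (upperBlock-lr a m) (upperBlock-rl m b)) (ℤₚ.*-zeroʳ (B a m)))))
      (trans (ℤₚ.+-identityʳ _) (sym (upperBlock-ll a b)))))
    (λ a b → trans (⊗-↑ X Y _ _) (trans (cong₂ _+_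
      (sumℤ-cong (λ m → cong₂ _*_ (upperBlock-ll a m) (upperBlock-lr m b)))
      (sumℤ-cong (λ m → cong₂ _*_ (upperBlock-lr a m) (upperBlock-rr m b))))
      (sym (upperBlock-lr a b))))
    (λ a b → trans (⊗-↑ X Y _ _) (trans (cong₂ _+_
      (sumℤ-zero (λ m → cong (_* Y (m ↑ˡ r) (b ↑ˡ r)) (upperBlock-rl a m)))
      (sumℤ-zero (λ m → trans (cong (X (k ↑ʳ a) (k ↑ʳ m) *_) (upperBlock-rl m b))
                              (ℤₚ.*-zeroʳ (X (k ↑ʳ a) (k ↑ʳ m))))))
      (sym (upperBlock-rl a b))))
    (λ a b → trans (⊗-↑ X Y _ _) (trans (cong₂ _+_
      (sumℤ-zero (λ m → cong (_* Y (m ↑ˡ r) (k ↑ʳ b)) (upperBlock-rl a m)))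
      (sumℤ-cong (λ m → cong₂ _*_ (upperBlock-rr a m) (upperBlock-rr m b))))
      (trans (ℤₚ.+-identityˡ _) (sym (upperBlock-rr a b)))))
    where
    X Y : Mat n n
    X = upperBlock A B D
    Y = upperBlock A′ B′ D′

  Id≐upperBlock : Id n ≐ upperBlock (Id k) (λ _ _ → + 0) (Id r)
  Id≐upperBlock = ≐-byBlocks k r
    (λ a b → trans (Id-injective (_↑ˡ r) (Finₚ.↑ˡ-injective r _ _) a b) (sym (upperBlock-ll a b)))
    (λ a b → trans (Id-offdiag n (↑ˡ≢↑ʳ a b)) (sym (upperBlock-lr a b)))
    (λ a b → trans (Id-offdiag n (↑ˡ≢↑ʳ b a ∘ sym)) (sym (upperBlock-rl a b)))
    (λ a b → trans (Id-injective (k ↑ʳ_) (Finₚ.↑ʳ-injective k _ _) a b) (sym (upperBlock-rr a b)))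

  shear : Mat k r → Mat n n
  shear B = upperBlock (Id k) B (Id r)

  upperBlock-⊗-shear : ∀ B D B′ →
    upperBlock (Id k) B D ⊗ shear B′ ≐ upperBlock (Id k) (λ a b → B′ a b + B a b) D
  upperBlock-⊗-shear B D B′ i j = trans (upperBlock-⊗ (Id k) B D (Id k) B′ (Id r) i j)
    (upperBlock-cong (⊗-identityˡ (Id k))
                     (λ a b → cong₂ _+_ (⊗-identityˡ B′ a b) (⊗-identityʳ B a b))
                     (⊗-identityʳ D) i j)

  shear-unimodular : ∀ B → Unimodular (shear B)
  shear-unimodular B = shear −B , cancel B −B (λ a b → ℤₚ.+-inverseˡ (B a b))
                                , cancel −B B (λ a b → ℤₚ.+-inverseʳ (B a b))
    where
    −B : Mat k r
    −B a b = - B a b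
    cancel : ∀ B B′ → (∀ a b → B′ a b + B a b ≡ + 0) → shear B ⊗ shear B′ ≐ Id n
    cancel B B′ B′+B≡0 i j = trans (upperBlock-⊗-shear B (Id r) B′ i j)
      (trans (upperBlock-cong (λ _ _ → refl) B′+B≡0 (λ _ _ → refl) i j) (sym (Id≐upperBlock i j)))

  ≐upperBlock : (H : Mat n n) → (∀ a b → H (k ↑ʳ a) (b ↑ˡ r) ≡ + 0) →
    H ≐ upperBlock (λ a b → H (a ↑ˡ r) (b ↑ˡ r))
                   (λ a b → H (a ↑ˡ r) (k ↑ʳ b))
                   (λ a b → H (k ↑ʳ a) (k ↑ʳ b))
  ≐upperBlock H lowerLeft≡0 = ≐-byBlocks k r
    (λ a b → sym (upperBlock-ll a b))
    (λ a b → sym (upperBlock-lr a b))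
    (λ a b → trans (lowerLeft≡0 a b) (sym (upperBlock-rl a b)))
    (λ a b → sym (upperBlock-rr a b))

  diagMat-++ : (xs : Fin k → ℕ) (ys : Fin r → ℕ) →
    diagMat (xs ++ ys) ≐ upperBlock (diagMat xs) (λ _ _ → + 0) (diagMat ys)
  diagMat-++ xs ys = ≐-byBlocks k r
    (λ a b → trans (diagMat≡*Id (xs ++ ys) _ _) (trans
      (cong₂ (λ x y → + x * y) (lookup-++ˡ xs ys a) (Id-injective (_↑ˡ r) (Finₚ.↑ˡ-injective r _ _) a b))
      (sym (trans (upperBlock-ll a b) (diagMat≡*Id xs a b)))))
    (λ a b → trans (diagMat≡*Id (xs ++ ys) _ _) (trans
      (cong (+ (xs ++ ys) (a ↑ˡ r) *_) (Id-offdiag n (↑ˡ≢↑ʳ a b)))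
      (trans (ℤₚ.*-zeroʳ (+ (xs ++ ys) (a ↑ˡ r))) (sym (upperBlock-lr a b)))))
    (λ a b → trans (diagMat≡*Id (xs ++ ys) _ _) (trans
      (cong (+ (xs ++ ys) (k ↑ʳ a) *_) (Id-offdiag n (↑ˡ≢↑ʳ b a ∘ sym)))
      (trans (ℤₚ.*-zeroʳ (+ (xs ++ ys) (k ↑ʳ a))) (sym (upperBlock-rl a b)))))
    (λ a b → trans (diagMat≡*Id (xs ++ ys) _ _) (trans
      (cong₂ (λ x y → + x * y) (lookup-++ʳ xs ys a) (Id-injective (k ↑ʳ_) (Finₚ.↑ʳ-injective k _ _) a b))
      (sym (trans (upperBlock-rr a b) (diagMat≡*Id ys a b)))))

  upperBlock-scalar-hasCr : ∀ {p} → 1 ℕ.< p → (B : Mat k r) →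
    HasCr (upperBlock (Id k) B (scalarMat r (+ p))) r
  upperBlock-scalar-hasCr {p} 1<p B =
    D , (D-positive , D-chain , Id n , shear −B , Id-unimodular , shear-unimodular −B , snf) , D-count
    where
    ones : Fin k → ℕ
    ones _ = 1
    ps : Fin r → ℕ
    ps _ = p
    D : Fin n → ℕ
    D = ones ++ ps
    −B : Mat k r
    −B a b = - B a b

    D-positive : ∀ i → 0 ℕ.< D i
    D-positive = ↑-cases k (λ i → 0 ℕ.< D i)
      (λ a → subst (0 ℕ.<_) (sym (lookup-++ˡ ones ps a)) (ℕ.s≤s ℕ.z≤n))
      (λ b → subst (0 ℕ.<_) (sym (lookup-++ʳ ones ps b)) (ℕₚ.<-trans (ℕ.s≤s ℕ.z≤n) 1<p))

    D-chain : ∀ i j → toℕ i ℕ.≤ toℕ j → D i ℕ∣.∣ D j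
    D-chain = ↑-cases k (λ i → ∀ j → toℕ i ℕ.≤ toℕ j → D i ℕ∣.∣ D j)
      (λ a j _ → subst (ℕ∣._∣ D j) (sym (lookup-++ˡ ones ps a)) (ℕ∣.1∣ D j))
      (λ a → ↑-cases k (λ j → toℕ (k ↑ʳ a) ℕ.≤ toℕ j → D (k ↑ʳ a) ℕ∣.∣ D j)
        (λ b ≤↑ˡ → ⊥-elim (ℕₚ.<⇒≱ (toℕ↑ˡ<toℕ↑ʳ b a) ≤↑ˡ))
        (λ b _ → subst₂ ℕ∣._∣_ (sym (lookup-++ʳ ones ps a)) (sym (lookup-++ʳ ones ps b)) ℕ∣.∣-refl))

    D-count : count>1 D ≡ r
    D-count = trans (count>1-↑ k D) (cong₂ ℕ._+_
      (trans (count>1-cong (lookup-++ˡ ones ps)) (count>1-none ones (λ _ → ℕₚ.≤-refl)))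
      (trans (count>1-cong (lookup-++ʳ ones ps)) (count>1-all ps (λ _ → 1<p))))

    Id-unimodular : Unimodular (Id n)
    Id-unimodular = Id n , ⊗-identityˡ (Id n) , ⊗-identityˡ (Id n)

    snf : (Id n ⊗ upperBlock (Id k) B (scalarMat r (+ p))) ⊗ shear −B ≐ diagMat D
    snf i j = begin
      ((Id n ⊗ upperBlock (Id k) B (scalarMat r (+ p))) ⊗ shear −B) i j
        ≡⟨ ⊗-congˡ (shear −B) (⊗-identityˡ _) i j ⟩
      (upperBlock (Id k) B (scalarMat r (+ p)) ⊗ shear −B) i j
        ≡⟨ upperBlock-⊗-shear B (scalarMat r (+ p)) −B i j ⟩
      upperBlock (Id k) (λ a b → - B a b + B a b) (scalarMat r (+ p)) i j
        ≡⟨ upperBlock-cong ones≐Id (λ a b → ℤₚ.+-inverseˡ (B a b)) ps≐scalar i j ⟩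
      upperBlock (diagMat ones) (λ _ _ → + 0) (diagMat ps) i j
        ≡⟨ sym (diagMat-++ ones ps i j) ⟩
      diagMat D i j ∎
      where
      open ≡-Reasoning
      ones≐Id : Id k ≐ diagMat ones
      ones≐Id a b = sym (trans (diagMat≡*Id ones a b) (ℤₚ.*-identityˡ (Id k a b)))
      ps≐scalar : scalarMat r (+ p) ≐ diagMat ps
      ps≐scalar a b = trans (scalarMat≡*Id r (+ p) a b) (sym (diagMat≡*Id ps a b))

HasCr-resp-≐ : ∀ {d} {A A′ : Mat d d} {c} → A ≐ A′ → HasCr A c → HasCr A′ c
HasCr-resp-≐ A≐A′ (D , (pos , chain , U , V , U-uni , V-uni , snf) , count≡) =
  D , (pos , chain , U , V , U-uni , V-uni ,
       λ i j → trans (sym (⊗-congˡ V (⊗-congʳ U A≐A′) i j)) (snf i j)) , count≡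

-- Smith normal form of a lattice of exponent p

-- The map in GroupIsoZpPow is only additive on pointwise sums and need not respect
-- pointwise equality of its arguments, so multiples are formed by repeated addition.
infixr 8 _×ᵥ_
_×ᵥ_ : ∀ {d} → ℕ → Vecℤ d → Vecℤ d
(zero  ×ᵥ x) _ = + 0
(suc m ×ᵥ x) i = x i + (m ×ᵥ x) i

×ᵥ-≗ : ∀ {d} m (x : Vecℤ d) i → (m ×ᵥ x) i ≡ + m * x i
×ᵥ-≗ zero    x i = sym (ℤₚ.*-zeroˡ (x i))
×ᵥ-≗ (suc m) x i = begin
  x i + (m ×ᵥ x) i    ≡⟨ cong (_+_ (x i)) (×ᵥ-≗ m x i) ⟩
  x i + + m * x i     ≡⟨ cong (_+ + m * x i) (ℤₚ.*-identityˡ (x i)) ⟨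
  + 1 * x i + + m * x i ≡⟨ ℤₚ.*-distribʳ-+ (x i) (+ 1) (+ m) ⟨
  + suc m * x i       ∎
  where open ≡-Reasoning

GroupIsoZpPow⇒p*∈lattice : ∀ {d p s} {A : Mat d d} → GroupIsoZpPow A p s →
  ∀ x → InLattice A (λ i → + p * x i)
GroupIsoZpPow⇒p*∈lattice {p = p} {A = A} (f , additive , _ , kernel) x =
  map₂ (λ A·y i → trans (sym (×ᵥ-≗ p x i)) (A·y i)) p×ᵥx∈lattice
  where
  additive′ : ∀ u v t → + p ∣ f (λ i → u i + v i) t - (f u t + f v t)
  additive′ u v t = ℤ∣.∣ᵤ⇒∣ (additive u v t)

  f-zero : ∀ t → + p ∣ f (0 ×ᵥ x) t
  f-zero t = subst (+ p ∣_) (ℤₚ.neg-involutive F)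
    (ℤ∣.∣m⇒∣-m (subst (+ p ∣_) (F-[F+F]≡-F F) (additive′ (0 ×ᵥ x) (0 ×ᵥ x) t)))
    where
    F : ℤ
    F = f (0 ×ᵥ x) t
    F-[F+F]≡-F : ∀ F → F - (F + F) ≡ - F
    F-[F+F]≡-F = solve-∀

  f-×ᵥ : ∀ m t → + p ∣ f (m ×ᵥ x) t - + m * f x t
  f-×ᵥ zero t = subst (+ p ∣_) (F≡F-0*G (f (0 ×ᵥ x) t) (f x t)) (f-zero t)
    where
    F≡F-0*G : ∀ F G → F ≡ F - + 0 * G
    F≡F-0*G = solve-∀
  f-×ᵥ (suc m) t = subst (+ p ∣_) (telescope (f (suc m ×ᵥ x) t) (f x t) (f (m ×ᵥ x) t) (+ m))
    (ℤ∣.∣m∣n⇒∣m+n (additive′ x (m ×ᵥ x) t) (f-×ᵥ m t))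
    where
    telescope : ∀ F G H M → (F - (G + H)) + (H - M * G) ≡ F - (+ 1 + M) * G
    telescope = solve-∀

  f[p×ᵥx]≡0 : ∀ t → + p ∣ f (p ×ᵥ x) t
  f[p×ᵥx]≡0 t = subst (+ p ∣_) (F-G+G≡F (f (p ×ᵥ x) t) (+ p * f x t))
    (ℤ∣.∣m∣n⇒∣m+n (f-×ᵥ p t) (ℤ∣.∣m⇒∣m*n (f x t) ℤ∣.∣-refl))
    where
    F-G+G≡F : ∀ F G → (F - G) + G ≡ F
    F-G+G≡F = solve-∀

  p×ᵥx∈lattice : InLattice A (p ×ᵥ x)
  p×ᵥx∈lattice = Equivalence.to (kernel (p ×ᵥ x))
    (λ t → ℤ∣.∣⇒∣ᵤ (subst (+ p ∣_) (sym (ℤₚ.+-identityʳ _)) (f[p×ᵥx]≡0 t)))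

module SmithNormalForm {n} {A : Mat n n} {D : Fin n → ℕ} (ed : ElementaryDivisors A D) where

  U V : Mat n n
  U = proj₁ (proj₂ (proj₂ ed))
  V = proj₁ (proj₂ (proj₂ (proj₂ ed)))

  private
    U-unimodular : Unimodular U
    U-unimodular = proj₁ (proj₂ (proj₂ (proj₂ (proj₂ ed))))
    V-unimodular : Unimodular V
    V-unimodular = proj₁ (proj₂ (proj₂ (proj₂ (proj₂ (proj₂ ed)))))
    U⊗A⊗V : (U ⊗ A) ⊗ V ≐ diagMat D
    U⊗A⊗V = proj₂ (proj₂ (proj₂ (proj₂ (proj₂ (proj₂ ed)))))

  U⁻¹ V⁻¹ : Mat n n
  U⁻¹ = proj₁ U-unimodular
  V⁻¹ = proj₁ V-unimodular

  private
    U⊗U⁻¹ : U ⊗ U⁻¹ ≐ Id n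
    U⊗U⁻¹ = proj₁ (proj₂ U-unimodular)
    U⁻¹⊗U : U⁻¹ ⊗ U ≐ Id n
    U⁻¹⊗U = proj₂ (proj₂ U-unimodular)
    V⊗V⁻¹ : V ⊗ V⁻¹ ≐ Id n
    V⊗V⁻¹ = proj₁ (proj₂ V-unimodular)

  U·A· : ∀ z i → (U · (A · z)) i ≡ + D i * (V⁻¹ · z) i
  U·A· z i = begin
    (U · (A · z)) i                 ≡⟨ ·-congʳ U (·-congʳ A (λ l → sym (inverse-· V V⁻¹ V⊗V⁻¹ z l))) i ⟩
    (U · (A · (V · y))) i           ≡⟨ sym (⊗-·-assoc U A (V · y) i) ⟩
    ((U ⊗ A) · (V · y)) i           ≡⟨ sym (⊗-·-assoc (U ⊗ A) V y i) ⟩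
    (((U ⊗ A) ⊗ V) · y) i           ≡⟨ ·-congˡ y U⊗A⊗V i ⟩
    (diagMat D · y) i               ≡⟨ diagMat-· D y i ⟩
    + D i * y i                     ∎
    where
    open ≡-Reasoning
    y = V⁻¹ · z

  ∣U·⇒∣ : ∀ {m} x → (∀ t → m ∣ (U · x) t) → ∀ i → m ∣ x i
  ∣U·⇒∣ x m∣Ux i = subst (_ ∣_) (inverse-· U⁻¹ U U⁻¹⊗U x i)
    (∣-sumℤ (λ l → ℤ∣.∣n⇒∣m*n (U⁻¹ i l) (m∣Ux l)))

  elementaryDivisor∣ : ∀ m → (∀ x → InLattice A (λ i → + m * x i)) → ∀ i → D i ℕ∣.∣ m
  elementaryDivisor∣ m m*∈A i = ℤ∣.∣⇒∣ᵤ (ℤ∣.divides ((V⁻¹ · y) i) (begin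
    + m                              ≡⟨ sym (ℤₚ.*-identityʳ (+ m)) ⟩
    + m * + 1                        ≡⟨ cong (+ m *_) (sym (trans (U⊗U⁻¹ i i) (Id-diag n i))) ⟩
    + m * (U ⊗ U⁻¹) i i              ≡⟨ *-distribˡ-sumℤ (+ m) (λ l → U i l * U⁻¹ l i) ⟩
    sumℤ (λ l → + m * (U i l * U⁻¹ l i)) ≡⟨ sumℤ-cong (λ l → m*[a*b]≡a*[m*b] (+ m) (U i l) (U⁻¹ l i)) ⟩
    (U · u) i                        ≡⟨ ·-congʳ U A·y i ⟩
    (U · (A · y)) i                  ≡⟨ U·A· y i ⟩
    + D i * (V⁻¹ · y) i              ≡⟨ ℤₚ.*-comm (+ D i) _ ⟩
    (V⁻¹ · y) i * + D i              ∎))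
    where
    open ≡-Reasoning
    u : Vecℤ n
    u l = + m * U⁻¹ l i
    y : Vecℤ n
    y = proj₁ (m*∈A (λ l → U⁻¹ l i))
    A·y : ∀ l → u l ≡ (A · y) l
    A·y = proj₂ (m*∈A (λ l → U⁻¹ l i))
    m*[a*b]≡a*[m*b] : ∀ m a b → m * (a * b) ≡ a * (m * b)
    m*[a*b]≡a*[m*b] = solve-∀

-- Linear dependence modulo a prime

euclidsLemmaℤ : ∀ {p} → Prime p → ∀ a b → + p ∣ a * b → + p ∣ a ⊎ + p ∣ b
euclidsLemmaℤ {p} p-prime a b p∣ab
  with euclidsLemma ℤ.∣ a ∣ ℤ.∣ b ∣ p-prime (subst (p ℕ∣.∣_) (ℤₚ.abs-* a b) (ℤ∣.∣⇒∣ᵤ p∣ab))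
... | inj₁ p∣a = inj₁ (ℤ∣.∣ᵤ⇒∣ p∣a)
... | inj₂ p∣b = inj₂ (ℤ∣.∣ᵤ⇒∣ p∣b)

prime∤1 : ∀ {p} → Prime p → ¬ (+ p ∣ + 1)
prime∤1 {p} p-prime p∣1 =
  ℕₚ.<⇒≢ (ℕ.nonTrivial⇒n>1 p ⦃ prime⇒nonTrivial p-prime ⦄) (sym (ℕ∣.∣1⇒≡1 (ℤ∣.∣⇒∣ᵤ p∣1)))

nonNegative-∣-<⇒≡0 : ∀ {p} x → + 0 ℤ.≤ x → x ℤ.< + p → + p ∣ x → x ≡ + 0
nonNegative-∣-<⇒≡0 (+ zero)  _ _   _   = refl
nonNegative-∣-<⇒≡0 (+ suc c) _ x<p p∣x = ⊥-elim (ℕ∣.>⇒∤ (ℤₚ.drop‿+<+ x<p) (ℤ∣.∣⇒∣ᵤ p∣x))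

positive-∣-antisym : ∀ {p} x → + 0 ℤ.< x → x ∣ + p → + p ∣ x → x ≡ + p
positive-∣-antisym x 0<x x∣p p∣x =
  trans (sym (ℤₚ.0≤i⇒+∣i∣≡i (ℤₚ.<⇒≤ 0<x)))
        (cong +_ (ℕ∣.∣-antisym (ℤ∣.∣⇒∣ᵤ x∣p) (ℤ∣.∣⇒∣ᵤ p∣x)))

DependentMod : ∀ {m k} → ℕ → (Fin m → Vecℤ k) → Set
DependentMod {m} p v = Σ (Fin m → ℤ) λ α →
  (∃ λ l → ¬ + p ∣ α l) × (∀ i → + p ∣ sumℤ (λ l → α l * v l i))

dependentMod-∷ : ∀ {p m k} (v : Fin (suc m) → Vecℤ (suc k)) → (∀ l → + p ∣ v l zero) →
  DependentMod p (λ l i → v (suc l) (suc i)) → DependentMod p v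
dependentMod-∷ {p} v p∣v₀ (α , (l , p∤αl) , p∣∑) = (+ 0 ∷ α) , (suc l , p∤αl) , p∣∑′
  where
  p∣∑′ : ∀ i → + p ∣ sumℤ (λ l → (+ 0 ∷ α) l * v l i)
  p∣∑′ zero    = ∣-sumℤ (λ l → ℤ∣.∣n⇒∣m*n ((+ 0 ∷ α) l) (p∣v₀ l))
  p∣∑′ (suc i) = subst (+ p ∣_) (sym (ℤₚ.+-identityˡ _)) (p∣∑ i)

eliminate : ∀ {m k} (v : Fin (suc m) → Vecℤ (suc k)) (pivot : Fin (suc m)) → Fin m → Vecℤ k
eliminate v pivot l i = v pivot zero * v (punchIn pivot l) (suc i) - v (punchIn pivot l) zero * v pivot (suc i)

dependentMod-eliminate : ∀ {p m k} → Prime p → (v : Fin (suc m) → Vecℤ (suc k)) (pivot : Fin (suc m)) →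
  ¬ + p ∣ v pivot zero → DependentMod p (eliminate v pivot) → DependentMod p v
dependentMod-eliminate {p} {m} p-prime v pivot p∤v₀ (α , (l , p∤αl) , p∣∑) =
  β , (punchIn pivot l , p∤βl) , p∣∑′
  where
  π : ℤ
  π = v pivot zero
  v′ : Fin m → Vecℤ (suc _)
  v′ = v ∘ punchIn pivot
  S : ℤ
  S = sumℤ (λ l → α l * v′ l zero)
  -- Scaling α by the pivot entry and inserting -S at the pivot cancels the first
  -- coordinate, while the others reproduce the relation among the eliminated vectors.
  β : Fin (suc m) → ℤ
  β = insertAt (λ l → π * α l) pivot (- S)

  p∤βl : ¬ + p ∣ β (punchIn pivot l)
  p∤βl p∣βl with euclidsLemmaℤ p-prime π (α l) (subst (+ p ∣_) (insertAt-punchIn _ pivot (- S) l) p∣βl)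
  ... | inj₁ p∣π  = p∤v₀ p∣π
  ... | inj₂ p∣αl = p∤αl p∣αl

  ∑β : ∀ i → sumℤ (λ l → β l * v l i) ≡ π * sumℤ (λ l → α l * v′ l i) - S * v pivot i
  ∑β i = begin
    sumℤ (λ l → β l * v l i)
      ≡⟨ sumℤ-remove pivot (λ l → β l * v l i) ⟩
    β pivot * v pivot i + sumℤ (λ l → β (punchIn pivot l) * v′ l i)
      ≡⟨ cong₂ _+_ (cong (_* v pivot i) (insertAt-lookup _ pivot (- S)))
                   (sumℤ-cong (λ l → cong (_* v′ l i) (insertAt-punchIn _ pivot (- S) l))) ⟩
    - S * v pivot i + sumℤ (λ l → π * α l * v′ l i)
      ≡⟨ cong (_+_ (- S * v pivot i)) (trans (sumℤ-cong (λ l → ℤₚ.*-assoc π (α l) (v′ l i)))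
                                              (sym (*-distribˡ-sumℤ π (λ l → α l * v′ l i)))) ⟩
    - S * v pivot i + π * sumℤ (λ l → α l * v′ l i)
      ≡⟨ swap S (v pivot i) (π * sumℤ (λ l → α l * v′ l i)) ⟩
    π * sumℤ (λ l → α l * v′ l i) - S * v pivot i ∎
    where
    open ≡-Reasoning
    swap : ∀ a b c → - a * b + c ≡ c - a * b
    swap = solve-∀

  ∑α-eliminate : ∀ i → sumℤ (λ l → α l * eliminate v pivot l i) ≡
    π * sumℤ (λ l → α l * v′ l (suc i)) - S * v pivot (suc i)
  ∑α-eliminate i = begin
    sumℤ (λ l → α l * (π * x l - y l * z))
      ≡⟨ sumℤ-cong (λ l → regroup (α l) π (x l) (y l) z) ⟩
    sumℤ (λ l → π * (α l * x l) + α l * y l * - z)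
      ≡⟨ sumℤ-distrib-+ (λ l → π * (α l * x l)) (λ l → α l * y l * - z) ⟩
    sumℤ (λ l → π * (α l * x l)) + sumℤ (λ l → α l * y l * - z)
      ≡⟨ cong₂ _+_ (*-distribˡ-sumℤ π (λ l → α l * x l)) (*-distribʳ-sumℤ (- z) (λ l → α l * y l)) ⟨
    π * sumℤ (λ l → α l * x l) + S * - z
      ≡⟨ cong (_+_ (π * sumℤ (λ l → α l * x l))) (sym (ℤₚ.neg-distribʳ-* S z)) ⟩
    π * sumℤ (λ l → α l * x l) - S * z ∎
    where
    open ≡-Reasoning
    x y : Fin m → ℤ
    x l = v′ l (suc i)
    y l = v′ l zero
    z : ℤ
    z = v pivot (suc i)
    regroup : ∀ a π x y z → a * (π * x - y * z) ≡ π * (a * x) + a * y * - z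
    regroup = solve-∀

  p∣∑′ : ∀ i → + p ∣ sumℤ (λ l → β l * v l i)
  p∣∑′ zero    = subst (+ p ∣_) (sym (trans (∑β zero) (cancel π S)))
                       (ℤ∣.divides (+ 0) (sym (ℤₚ.*-zeroˡ (+ p))))
    where
    cancel : ∀ π S → π * S - S * π ≡ + 0
    cancel = solve-∀
  p∣∑′ (suc i) = subst (+ p ∣_) (trans (∑α-eliminate i) (sym (∑β (suc i)))) (p∣∑ i)

dependentMod : ∀ {p} → Prime p → ∀ k (v : Fin (suc k) → Vecℤ k) → DependentMod p v
dependentMod p-prime zero v = (λ _ → + 1) , (zero , prime∤1 p-prime) , λ ()
dependentMod {p} p-prime (suc k) v with Finₚ.any? (λ l → ¬? (+ p ℤ∣.∣? v l zero))
... | yes (pivot , p∤v₀) =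
  dependentMod-eliminate p-prime v pivot p∤v₀ (dependentMod p-prime k (eliminate v pivot))
... | no ∄pivot = dependentMod-∷ v p∣v₀ (dependentMod p-prime k (λ l i → v (suc l) (suc i)))
  where
  p∣v₀ : ∀ l → + p ∣ v l zero
  p∣v₀ l = decidable-stable (+ p ℤ∣.∣? v l zero) (λ p∤v₀ → ∄pivot (l , p∤v₀))

-- Back substitution

UpperTriangular : ∀ {n} → Mat n n → Set
UpperTriangular {n} T = ∀ (i j : Fin n) → j Fin.< i → T i j ≡ + 0

backSubstitution : ∀ {n} (T : Mat n n) → UpperTriangular T → (∀ i → T i i ≢ + 0) →
  (y t : Vecℤ n) → (∀ i → (T · y) i ≡ t i) →
  ∀ j → (∀ i → j Fin.< i → t i ≡ + 0) → T j j * y j ≡ t j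
backSubstitution {suc n} T T-upper T-diag≢0 y t T·y≡t j t-lower≡0 = row j t-lower≡0
  where
  T′ : Mat n n
  T′ i l = T (suc i) (suc l)
  y′ : Vecℤ n
  y′ = y ∘ suc

  T′·y′≡t′ : ∀ i → (T′ · y′) i ≡ t (suc i)
  T′·y′≡t′ i = begin
    (T′ · y′) i
      ≡⟨ ℤₚ.+-identityˡ _ ⟨
    + 0 + (T′ · y′) i
      ≡⟨ cong (λ a → a * y zero + (T′ · y′) i) (T-upper (suc i) zero ℕ.z<s) ⟨
    T (suc i) zero * y zero + (T′ · y′) i
      ≡⟨ T·y≡t (suc i) ⟩
    t (suc i) ∎
    where open ≡-Reasoning

  tail-backSubstitution : ∀ j → (∀ i → j Fin.< i → t (suc i) ≡ + 0) → T′ j j * y′ j ≡ t (suc j)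
  tail-backSubstitution = backSubstitution T′ (λ i j j<i → T-upper (suc i) (suc j) (ℕ.s≤s j<i))
                            (T-diag≢0 ∘ suc) y′ (t ∘ suc) T′·y′≡t′

  y′≡0 : (∀ i → t (suc i) ≡ + 0) → ∀ l → y′ l ≡ + 0
  y′≡0 t′≡0 l
    with ℤₚ.i*j≡0⇒i≡0∨j≡0 (T′ l l) (trans (tail-backSubstitution l (λ i _ → t′≡0 i)) (t′≡0 l))
  ... | inj₁ T′ll≡0 = ⊥-elim (T-diag≢0 (suc l) T′ll≡0)
  ... | inj₂ y′l≡0  = y′l≡0

  row : ∀ j → (∀ i → j Fin.< i → t i ≡ + 0) → T j j * y j ≡ t j
  row zero t-lower≡0 = begin
    T zero zero * y zero                                   ≡⟨ ℤₚ.+-identityʳ _ ⟨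
    T zero zero * y zero + + 0                             ≡⟨ cong (_+_ (T zero zero * y zero)) (sumℤ-zero T₀y′≡0) ⟨
    T zero zero * y zero + sumℤ (λ l → T zero (suc l) * y′ l) ≡⟨ T·y≡t zero ⟩
    t zero                                                 ∎
    where
    open ≡-Reasoning
    T₀y′≡0 : ∀ l → T zero (suc l) * y′ l ≡ + 0
    T₀y′≡0 l = trans (cong (T zero (suc l) *_) (y′≡0 (λ i → t-lower≡0 (suc i) ℕ.z<s) l))
                     (ℤₚ.*-zeroʳ (T zero (suc l)))
  row (suc j) t-lower≡0 = tail-backSubstitution j (λ i j<i → t-lower≡0 (suc i) (ℕ.s≤s j<i))

-- The lower right block

module CrForcesScalarBlock (p : ℕ) (p-prime : Prime p) (k r : ℕ) (H : Mat (k ℕ.+ r) (k ℕ.+ r))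
  (iso : IsPPowerSimplex p H) (hnf : IsHNF H)
  (H-ll : ∀ (a b : Fin k) → H (a ↑ˡ r) (b ↑ˡ r) ≡ Id k a b)
  (H-rl : ∀ (a : Fin r) (b : Fin k) → H (k ↑ʳ a) (b ↑ˡ r) ≡ + 0)
  {D : Fin (k ℕ.+ r) → ℕ} (ed : ElementaryDivisors H D) (count≡r : count>1 D ≡ r) where

  n : ℕ
  n = k ℕ.+ r

  B : Mat k r
  B a j = H (a ↑ˡ r) (k ↑ʳ j)

  C : Mat r r
  C i j = H (k ↑ʳ i) (k ↑ʳ j)

  open SmithNormalForm {A = H} {D = D} ed

  D∣p : ∀ i → D i ℕ∣.∣ p
  D∣p = elementaryDivisor∣ p (GroupIsoZpPow⇒p*∈lattice {A = H} (proj₂ iso))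

  D-last>1 : ∀ b → 1 ℕ.< D (k ↑ʳ b)
  D-last>1 = count>1≡r⇒last>1 k D (proj₁ ed) (proj₁ (proj₂ ed)) count≡r

  D-last≡p : ∀ b → D (k ↑ʳ b) ≡ p
  D-last≡p b = [ (λ D≡1 → ⊥-elim (ℕₚ.<⇒≢ (D-last>1 b) (sym D≡1))) , id ]′
                 (prime⇒irreducible p-prime (D∣p (k ↑ʳ b)))

  p∣U·H·-last : ∀ z b → + p ∣ (U · (H · z)) (k ↑ʳ b)
  p∣U·H·-last z b = subst (+ p ∣_) (sym (trans (U·A· z (k ↑ʳ b)) (cong (λ d → + d * y) (D-last≡p b))))
                                   (ℤ∣.∣m⇒∣m*n y ℤ∣.∣-refl)
    where
    y : ℤ
    y = (V⁻¹ · z) (k ↑ʳ b)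

  module Column (j : Fin r) where

    v : Fin (suc k) → Vecℤ k
    v zero    a = sumℤ (λ i → U (a ↑ˡ r) (k ↑ʳ i) * C i j)
    v (suc m) a = U (a ↑ˡ r) (m ↑ˡ r)

    relation : DependentMod p v
    relation = dependentMod p-prime k v

    α : Fin (suc k) → ℤ
    α = proj₁ relation

    wᵘ zᵘ : Vecℤ k
    wᵘ = α ∘ suc
    zᵘ m = α (suc m) - α zero * B m j

    wₗ zₗ : Vecℤ r
    wₗ i = α zero * C i j
    zₗ i = α zero * Id r i j

    w z : Vecℤ n
    w = wᵘ ++ wₗ
    z = zᵘ ++ zₗ

    H·z≡w : ∀ t → (H · z) t ≡ w t
    H·z≡w = ↑-cases k (λ t → (H · z) t ≡ w t) upper lower
      where
      open ≡-Reasoning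
      upper : ∀ a → (H · z) (a ↑ˡ r) ≡ w (a ↑ˡ r)
      upper a = begin
        (H · z) (a ↑ˡ r)
          ≡⟨ sumℤ-↑ k (λ l → H (a ↑ˡ r) l * z l) ⟩
        sumℤ (λ m → H (a ↑ˡ r) (m ↑ˡ r) * z (m ↑ˡ r)) + sumℤ (λ i → B a i * z (k ↑ʳ i))
          ≡⟨ cong₂ _+_ (sumℤ-cong (λ m → cong₂ _*_ (H-ll a m) (lookup-++ˡ zᵘ zₗ m)))
                       (sumℤ-cong (λ i → cong (B a i *_) (lookup-++ʳ zᵘ zₗ i))) ⟩
        sumℤ (λ m → Id k a m * (α (suc m) - α zero * B m j)) + sumℤ (λ i → B a i * (α zero * Id r i j))
          ≡⟨ cong₂ _+_ (sumℤ-Id* a (λ m → α (suc m) - α zero * B m j))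
                       (trans (sumℤ-cong (λ i → sym (ℤₚ.*-assoc (B a i) (α zero) (Id r i j))))
                              (sumℤ-*Id (λ i → B a i * α zero) j)) ⟩
        α (suc a) - α zero * B a j + B a j * α zero
          ≡⟨ cancel (α (suc a)) (α zero) (B a j) ⟩
        α (suc a)
          ≡⟨ lookup-++ˡ wᵘ wₗ a ⟨
        w (a ↑ˡ r) ∎
        where
        cancel : ∀ x y b → x - y * b + b * y ≡ x
        cancel = solve-∀
      lower : ∀ b → (H · z) (k ↑ʳ b) ≡ w (k ↑ʳ b)
      lower b = begin
        (H · z) (k ↑ʳ b)
          ≡⟨ sumℤ-↑ k (λ l → H (k ↑ʳ b) l * z l) ⟩
        sumℤ (λ m → H (k ↑ʳ b) (m ↑ˡ r) * z (m ↑ˡ r)) + sumℤ (λ i → C b i * z (k ↑ʳ i))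
          ≡⟨ cong₂ _+_ (sumℤ-zero (λ m → trans (cong (_* z (m ↑ˡ r)) (H-rl b m)) (ℤₚ.*-zeroˡ (z (m ↑ˡ r)))))
                       (sumℤ-cong (λ i → trans (cong (C b i *_) (lookup-++ʳ zᵘ zₗ i))
                                               (sym (ℤₚ.*-assoc (C b i) (α zero) (Id r i j))))) ⟩
        + 0 + sumℤ (λ i → C b i * α zero * Id r i j)
          ≡⟨ trans (ℤₚ.+-identityˡ _) (sumℤ-*Id (λ i → C b i * α zero) j) ⟩
        C b j * α zero
          ≡⟨ ℤₚ.*-comm (C b j) (α zero) ⟩
        α zero * C b j
          ≡⟨ lookup-++ʳ wᵘ wₗ b ⟨
        w (k ↑ʳ b) ∎

    U·w≡∑αv : ∀ a → (U · w) (a ↑ˡ r) ≡ sumℤ (λ l → α l * v l a)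
    U·w≡∑αv a = begin
      (U · w) (a ↑ˡ r)
        ≡⟨ sumℤ-↑ k (λ l → U (a ↑ˡ r) l * w l) ⟩
      sumℤ (λ m → U (a ↑ˡ r) (m ↑ˡ r) * w (m ↑ˡ r)) + sumℤ (λ i → U (a ↑ˡ r) (k ↑ʳ i) * w (k ↑ʳ i))
        ≡⟨ cong₂ _+_ (sumℤ-cong (λ m → trans (cong (U (a ↑ˡ r) (m ↑ˡ r) *_) (lookup-++ˡ wᵘ wₗ m))
                                             (ℤₚ.*-comm (U (a ↑ˡ r) (m ↑ˡ r)) (α (suc m)))))
                     (sumℤ-cong (λ i → trans (cong (U (a ↑ˡ r) (k ↑ʳ i) *_) (lookup-++ʳ wᵘ wₗ i))
                                             (swap (U (a ↑ˡ r) (k ↑ʳ i)) (α zero) (C i j)))) ⟩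
      sumℤ (λ m → α (suc m) * v (suc m) a) + sumℤ (λ i → α zero * (U (a ↑ˡ r) (k ↑ʳ i) * C i j))
        ≡⟨ cong (_+_ (sumℤ (λ m → α (suc m) * v (suc m) a)))
                (sym (*-distribˡ-sumℤ (α zero) (λ i → U (a ↑ˡ r) (k ↑ʳ i) * C i j))) ⟩
      sumℤ (λ m → α (suc m) * v (suc m) a) + α zero * v zero a
        ≡⟨ ℤₚ.+-comm _ (α zero * v zero a) ⟩
      sumℤ (λ l → α l * v l a) ∎
      where
      open ≡-Reasoning
      swap : ∀ u x c → u * (x * c) ≡ x * (u * c)
      swap = solve-∀

    p∣w : ∀ t → + p ∣ w t
    p∣w = ∣U·⇒∣ w (↑-cases k (λ t → + p ∣ (U · w) t)
      (λ a → subst (+ p ∣_) (sym (U·w≡∑αv a)) (proj₂ (proj₂ relation) a))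
      (λ b → subst (+ p ∣_) (·-congʳ U H·z≡w (k ↑ʳ b)) (p∣U·H·-last z b)))

    p∤α₀ : ¬ + p ∣ α zero
    p∤α₀ = nonzero-coefficient (proj₁ (proj₂ relation))
      where
      nonzero-coefficient : (∃ λ l → ¬ + p ∣ α l) → ¬ + p ∣ α zero
      nonzero-coefficient (zero  , p∤α₀)  = p∤α₀
      nonzero-coefficient (suc m , p∤αm) = ⊥-elim (p∤αm (subst (+ p ∣_) (lookup-++ˡ wᵘ wₗ m) (p∣w (m ↑ˡ r))))

    p∣C·j : ∀ i → + p ∣ C i j
    p∣C·j i = [ ⊥-elim ∘ p∤α₀ , id ]′
      (euclidsLemmaℤ p-prime (α zero) (C i j) (subst (+ p ∣_) (lookup-++ʳ wᵘ wₗ i) (p∣w (k ↑ʳ i))))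

  C-upper : UpperTriangular C
  C-upper i j j<i = proj₁ hnf (k ↑ʳ i) (k ↑ʳ j) (↑ʳ-mono-< k j<i)

  C-diag>0 : ∀ i → + 0 ℤ.< C i i
  C-diag>0 i = proj₁ (proj₂ hnf) (k ↑ʳ i)

  C-diag≡p : ∀ j → C j j ≡ + p
  C-diag≡p j = positive-∣-antisym (C j j) (C-diag>0 j) Cjj∣p (Column.p∣C·j j j)
    where
    open ≡-Reasoning
    pe∈lattice : InLattice H (λ l → + p * Id n l (k ↑ʳ j))
    pe∈lattice = GroupIsoZpPow⇒p*∈lattice {A = H} (proj₂ iso) (λ l → Id n l (k ↑ʳ j))
    y : Vecℤ n
    y = proj₁ pe∈lattice
    y′ : Vecℤ r
    y′ = y ∘ (k ↑ʳ_)

    C·y′≡pe : ∀ i → (C · y′) i ≡ + p * Id r i j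
    C·y′≡pe i = sym (begin
      + p * Id r i j                  ≡⟨ cong (+ p *_) (Id-injective (k ↑ʳ_) (Finₚ.↑ʳ-injective k _ _) i j) ⟨
      + p * Id n (k ↑ʳ i) (k ↑ʳ j)    ≡⟨ proj₂ pe∈lattice (k ↑ʳ i) ⟩
      (H · y) (k ↑ʳ i)                ≡⟨ sumℤ-↑ k (λ l → H (k ↑ʳ i) l * y l) ⟩
      sumℤ (λ m → H (k ↑ʳ i) (m ↑ˡ r) * y (m ↑ˡ r)) + (C · y′) i
        ≡⟨ cong (_+ (C · y′) i) (sumℤ-zero (λ m → trans (cong (_* y (m ↑ˡ r)) (H-rl i m))
                                                        (ℤₚ.*-zeroˡ (y (m ↑ˡ r))))) ⟩
      + 0 + (C · y′) i                ≡⟨ ℤₚ.+-identityˡ _ ⟩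
      (C · y′) i                      ∎)

    Cjj*y′j≡p : C j j * y′ j ≡ + p
    Cjj*y′j≡p = begin
      C j j * y′ j     ≡⟨ backSubstitution C C-upper C-diag≢0 y′ (λ i → + p * Id r i j) C·y′≡pe j pe-below≡0 ⟩
      + p * Id r j j   ≡⟨ cong (+ p *_) (Id-diag r j) ⟩
      + p * + 1        ≡⟨ ℤₚ.*-identityʳ (+ p) ⟩
      + p              ∎
      where
      C-diag≢0 : ∀ i → C i i ≢ + 0
      C-diag≢0 i Cii≡0 = ℤₚ.<-irrefl (sym Cii≡0) (C-diag>0 i)
      pe-below≡0 : ∀ i → j Fin.< i → + p * Id r i j ≡ + 0
      pe-below≡0 i j<i = trans (cong (+ p *_) (Id-offdiag r (ℕₚ.<⇒≢ j<i ∘ cong toℕ ∘ sym))) (ℤₚ.*-zeroʳ (+ p))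

    Cjj∣p : C j j ∣ + p
    Cjj∣p = ℤ∣.divides (y′ j) (trans (sym Cjj*y′j≡p) (ℤₚ.*-comm (C j j) (y′ j)))

  C-above≡0 : ∀ i j → i Fin.< j → C i j ≡ + 0
  C-above≡0 i j i<j =
    nonNegative-∣-<⇒≡0 (C i j) 0≤Cij (subst (C i j ℤ.<_) (C-diag≡p j) Cij<Cjj) (Column.p∣C·j j i)
    where
    0≤Cij : + 0 ℤ.≤ C i j
    0≤Cij = proj₁ (proj₂ (proj₂ hnf) (k ↑ʳ i) (k ↑ʳ j) (↑ʳ-mono-< k i<j))
    Cij<Cjj : C i j ℤ.< C j j
    Cij<Cjj = proj₂ (proj₂ (proj₂ hnf) (k ↑ʳ i) (k ↑ʳ j) (↑ʳ-mono-< k i<j))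

  C-offdiag≡0 : ∀ i j → i ≢ j → C i j ≡ + 0
  C-offdiag≡0 i j i≢j = trichotomy (Finₚ.<-cmp i j)
    where
    trichotomy : Tri (i Fin.< j) (i ≡ j) (j Fin.< i) → C i j ≡ + 0
    trichotomy (tri< i<j _ _) = C-above≡0 i j i<j
    trichotomy (tri≈ _ i≡j _) = ⊥-elim (i≢j i≡j)
    trichotomy (tri> _ _ j<i) = C-upper i j j<i

  C≡pE : ∀ i j → C i j ≡ scalarMat r (+ p) i j
  C≡pE i j = trans (case-on (i ≟ j)) (sym (scalarMat≡*Id r (+ p) i j))
    where
    case-on : Dec (i ≡ j) → C i j ≡ + p * Id r i j
    case-on (yes refl) =
      trans (C-diag≡p i) (sym (trans (cong (+ p *_) (Id-diag r i)) (ℤₚ.*-identityʳ (+ p))))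
    case-on (no  i≢j)  =
      trans (C-offdiag≡0 i j i≢j) (sym (trans (cong (+ p *_) (Id-offdiag r i≢j)) (ℤₚ.*-zeroʳ (+ p))))

lemma3p7 : (p : ℕ) → Prime p → (k r : ℕ) → (H : Mat (k ℕ.+ r) (k ℕ.+ r)) →
    IsPPowerSimplex p H → IsHNF H →
    (∀ (i j : Fin k) → H (i ↑ˡ r) (j ↑ˡ r) ≡ Id k i j) →
    (∀ (i : Fin r) (j : Fin k) → H (k ↑ʳ i) (j ↑ˡ r) ≡ + 0) →
    HasCr H r ⇔ (∀ (i j : Fin r) → H (k ↑ʳ i) (k ↑ʳ j) ≡ scalarMat r (+ p) i j)
lemma3p7 p p-prime k r H iso hnf H-ll H-rl = mk⇔
  (λ (_ , ed , count≡r) → CrForcesScalarBlock.C≡pE p p-prime k r H iso hnf H-ll H-rl ed count≡r)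
  (λ C≡pE → HasCr-resp-≐ (λ i j → sym (H≐block C≡pE i j)) (upperBlock-scalar-hasCr 1<p B))
  where
  open Blocks k r
  B : Mat k r
  B a b = H (a ↑ˡ r) (k ↑ʳ b)
  1<p : 1 ℕ.< p
  1<p = ℕ.nonTrivial⇒n>1 p ⦃ prime⇒nonTrivial p-prime ⦄
  H≐block : (∀ i j → H (k ↑ʳ i) (k ↑ʳ j) ≡ scalarMat r (+ p) i j) → H ≐ upperBlock (Id k) B (scalarMat r (+ p))
  H≐block C≡pE i j = trans (≐upperBlock H H-rl i j) (upperBlock-cong H-ll (λ _ _ → refl) C≡pE i j)
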